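{- Let $a$ be an odd positive integer and $b$ an even positive integer with $a<b$. The subtraction game $\mathcal{S}(1,a,b)$ is periodic with period $a+b$ and nim-sequence $(01)^{b/2}(23)^{(a-1)/2}2$. Moreover, the subtraction set has expansion $\big(\{1,3,\ldots,a\}\cup\{b,b+2,\ldots,b+a-1\}\big)^{*(a+b)}$.
   Context: For a finite set $S$ of positive integers, the subtraction game $\mathcal{S}(S)$ is played on a single pile: two players alternately remove $s\in S$ coins (at most the pile size); the last mover wins. The nim-value is $\mathcal{G}(n)=\operatorname{mex}\{\mathcal{G}(n-s): s\in S, s\le n\}$. Words of single digits are written by juxtaposition, and $x^m$ denotes $m$-fold repetition of the block $x$ ($x^0$ is empty). "The game is periodic with period $p$ and nim-sequence $W$" ($W$ a word of length $p$) means $\mathcal{G}(n+p)=\mathcal{G}(n)$ for all $n\ge0$, $p$ is the least such, and $\mathcal{G}(n)$ is the $((n\bmod p)+1)$-st letter of $W$ for all $n\ge0$. The expansion of $S$ is $S^{ex}=\{s\ge1:\mathcal{G}(n+s)\ne\mathcal{G}(n)\ \forall n\ge0\}$; "has expansion $T$" means $S^{ex}=T$. For a set $X$ and $p\ge1$, $X^{*p}=\{x+mp:x\in X,m\ge0\}$. -}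

module Defs where

open import Data.Nat using (ℕ; zero; suc; _+_; _*_; _∸_; _≤_; _<_; _≡ᵇ_; _≤ᵇ_)
open import Data.Bool using (Bool; true; false; if_then_else_; _∧_; _∨_)
open import Data.List using (List; []; _∷_; _++_; length)
open import Data.Product using (_×_; Σ; ∃; ∃-syntax)
open import Data.Sum using (_⊎_)
open import Relation.Nullary using (¬_)
open import Relation.Binary.PropositionalEquality using (_≡_; _≢_)

elemᵇ : ℕ → List ℕ → Bool
elemᵇ k []       = false
elemᵇ k (x ∷ xs) = (k ≡ᵇ x) ∨ elemᵇ k xs

-- mex: least natural number not in the list (it is ≤ length l)
mex : List ℕ → ℕ
mex l = search (length l) 0
  where
  search : ℕ → ℕ → ℕ
  search zero    k = k
  search (suc f) k = if elemᵇ k l then search f (suc k) else k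

-- n-th element (0-based) with default 0 outside the range
nth : List ℕ → ℕ → ℕ
nth []       _       = 0
nth (x ∷ xs) zero    = x
nth (x ∷ xs) (suc n) = nth xs n

-- table S n = [G(n-1), G(n-2), ..., G(0)]  (most recent first)
table : List ℕ → ℕ → List ℕ
-- options G(n - s) for s ∈ S with 1 ≤ s ≤ n, read from the reversed table t of length n
options : List ℕ → ℕ → List ℕ → List ℕ
options []       n t = []
options (s ∷ ss) n t =
  if (1 ≤ᵇ s) ∧ (s ≤ᵇ n)
    then nth t (s ∸ 1) ∷ options ss n t
    else options ss n t
table S zero    = []
table S (suc n) = mex (options S n (table S n)) ∷ table S n

nimValue : List ℕ → ℕ → ℕ
nimValue S n = mex (options S n (table S n))

rep : ℕ → List ℕ → List ℕ
rep zero    x = []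
rep (suc m) x = x ++ rep m x

PeriodicWith : List ℕ → ℕ → List ℕ → Set
PeriodicWith S p W =
  (1 ≤ p)
  × (∀ n → nimValue S (n + p) ≡ nimValue S n)
  × (∀ q → 1 ≤ q → q < p → ¬ (∀ n → nimValue S (n + q) ≡ nimValue S n))
  × (length W ≡ p)
  × (∀ k r → r < p → nimValue S (k * p + r) ≡ nth W r)

InExpansion : List ℕ → ℕ → Set
InExpansion S s = (1 ≤ s) × (∀ n → nimValue S (n + s) ≢ nimValue S n)

HasExpansion : List ℕ → (ℕ → Set) → Set
HasExpansion S T = ∀ s → (InExpansion S s → T s) × (T s → InExpansion S s)

StarClosure : (ℕ → Set) → ℕ → ℕ → Set
StarClosure X p s = ∃[ x ] ∃[ m ] (X x × s ≡ x + m * p)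

-- Write p = a + b and let g(r), for a residue r < p, be the r-th letter of
-- (01)^{b/2} (23)^{(a-1)/2} 2: the residues below b form the low block with
-- values 0,1 by parity, the others the high block with values 2,3 by parity.  Call a
-- shift t separating when r ↦ r + t (mod p) changes g everywhere on the
-- cycle; these are exactly the odd t ≤ a and the even t in [b, p).  The moves
-- 1, a, b are separating and the values below g(r) are reached by
-- non-wrapping moves, so n ↦ g(n mod p) obeys the mex recursion and equals G.
-- Periodicity, minimality of p and the nim-sequence follow at once, and
-- since G(n + s) ≠ G(n) for all n says that s mod p separates, the expansion
-- is the set of s whose residue is separating, i.e. the given set closed
-- under adding multiples of p.
module Submission where

open import Defs
open import Data.Bool using (Bool; true; false; not; _∧_; _xor_; if_then_else_; T)
open import Data.Bool.Properties
  using (∨-zeroʳ; T-≡; T-∧; xor-identityʳ; xor-same; xor-assoc; xor-comm; not-injective; not-¬)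
open import Data.Empty using (⊥-elim)
open import Data.Fin using (Fin; toℕ)
open import Data.Fin.Properties using (pigeonhole; toℕ<n)
open import Data.List using (List; []; _∷_; _++_; length; lookup)
open import Data.List.Properties using (length-++)
open import Data.List.Membership.Propositional using (_∈_; _∉_)
open import Data.List.Relation.Unary.Any using (here; there; index)
open import Data.List.Relation.Unary.Any.Properties using (lookup-index)
open import Data.Nat
open import Data.Nat.Properties
open import Data.Nat.Induction using (<-rec)
open import Data.Nat.DivMod
  using (_/_; _%_; m≡m%n+[m/n]*n; %-congˡ; /-congˡ; [m+kn]%n≡m%n; [m+n]%n≡m%n; m≤n⇒[n∸m]%m≡n%m;
         m<n⇒m%n≡m; m%n<n; m%n≤m; m%n%n≡m%n; n%n≡0; %-distribˡ-+; m*n/n≡m)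
open import Data.Product using (_×_; _,_; ∃-syntax; proj₁; proj₂)
open import Data.Sum using (_⊎_; inj₁; inj₂)
open import Data.Unit using (tt)
open import Function.Bundles using (Equivalence)
open import Relation.Binary.PropositionalEquality
open import Relation.Nullary using (¬_; yes; no)

≡ᵇ-refl : ∀ n → (n ≡ᵇ n) ≡ true
≡ᵇ-refl zero    = refl
≡ᵇ-refl (suc n) = ≡ᵇ-refl n

∈⇒elemᵇ : ∀ {k l} → k ∈ l → elemᵇ k l ≡ true
∈⇒elemᵇ {k} (here refl) rewrite ≡ᵇ-refl k = refl
∈⇒elemᵇ {k} (there {x} k∈l) rewrite ∈⇒elemᵇ k∈l = ∨-zeroʳ (k ≡ᵇ x)

elemᵇ⇒∈ : ∀ {k} l → elemᵇ k l ≡ true → k ∈ l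
elemᵇ⇒∈ {k} (x ∷ l) e with k ≡ᵇ x in k≡ᵇx
... | true  = here (≡ᵇ⇒≡ k x (subst T (sym k≡ᵇx) tt))
... | false = there (elemᵇ⇒∈ l e)

∉⇒elemᵇ : ∀ {k l} → k ∉ l → elemᵇ k l ≡ false
∉⇒elemᵇ {k} {l} k∉l with elemᵇ k l in e
... | true  = ⊥-elim (k∉l (elemᵇ⇒∈ l e))
... | false = refl

-- If l contains all of 0, …, v-1 then it has at least v entries (pigeonhole on positions).
all-below⇒≤length : ∀ v l → (∀ j → j < v → j ∈ l) → v ≤ length l
all-below⇒≤length v l below = ≮⇒≥ λ len<v →
  let (i , j , i<j , same) = pigeonhole len<v position
  in <⇒≢ i<j (trans (at i) (trans (cong (lookup l) same) (sym (at j))))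
  where
  position : Fin v → Fin (length l)
  position i = index (below (toℕ i) (toℕ<n i))
  at : ∀ i → toℕ i ≡ lookup l (position i)
  at i = lookup-index (below (toℕ i) (toℕ<n i))

-- Defs' mex scans k = 0, 1, 2, … for at most length l steps, stopping at the
-- first k ∉ l.  `scan` is that loop made visible; the two agree definitionally
-- once the length of l is known, which we use for the short option lists.
scan : List ℕ → ℕ → ℕ → ℕ
scan l zero    k = k
scan l (suc f) k = if elemᵇ k l then scan l f (suc k) else k

mex≡scan : ∀ l → length l ≤ 3 → mex l ≡ scan l (length l) 0
mex≡scan []               _ = refl
mex≡scan (_ ∷ [])         _ = refl
mex≡scan (_ ∷ _ ∷ [])     _ = refl
mex≡scan (_ ∷ _ ∷ _ ∷ []) _ = refl
mex≡scan (_ ∷ _ ∷ _ ∷ _ ∷ _) (s≤s (s≤s (s≤s ())))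

scan-stops : ∀ l f k v → k ≤ v → v ≤ k + f →
  (∀ j → k ≤ j → j < v → j ∈ l) → v ∉ l → scan l f k ≡ v
scan-stops l zero k v k≤v v≤k+0 _ _ = ≤-antisym k≤v (subst (v ≤_) (+-identityʳ k) v≤k+0)
scan-stops l (suc f) k v k≤v v≤k+f below v∉l with m≤n⇒m<n∨m≡n k≤v
... | inj₂ refl rewrite ∉⇒elemᵇ v∉l = refl
... | inj₁ k<v rewrite ∈⇒elemᵇ (below k ≤-refl k<v) =
  scan-stops l f (suc k) v k<v (subst (v ≤_) (+-suc k f) v≤k+f)
    (λ j k<j j<v → below j (≤-trans (n≤1+n k) k<j) j<v) v∉l

mex-spec : ∀ l v → length l ≤ 3 → (∀ j → j < v → j ∈ l) → v ∉ l → mex l ≡ v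
mex-spec l v len≤3 below v∉l =
  trans (mex≡scan l len≤3)
        (scan-stops l (length l) 0 v z≤n (all-below⇒≤length v l below) (λ j _ → below j) v∉l)

legal⇒guard : ∀ {s n} → 1 ≤ s → s ≤ n → ((1 ≤ᵇ s) ∧ (s ≤ᵇ n)) ≡ true
legal⇒guard {s} {n} 1≤s s≤n
  rewrite Equivalence.to T-≡ (≤⇒≤ᵇ 1≤s) | Equivalence.to T-≡ (≤⇒≤ᵇ s≤n) = refl

guard⇒legal : ∀ s n → ((1 ≤ᵇ s) ∧ (s ≤ᵇ n)) ≡ true → 1 ≤ s × s ≤ n
guard⇒legal s n e with Equivalence.to T-∧ (Equivalence.from T-≡ e)
... | 1≤ᵇs , s≤ᵇn = ≤ᵇ⇒≤ 1 s 1≤ᵇs , ≤ᵇ⇒≤ s n s≤ᵇn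

Reaches : List ℕ → ℕ → List ℕ → ℕ → Set
Reaches S n t x = ∃[ s ] (s ∈ S × 1 ≤ s × s ≤ n × nth t (s ∸ 1) ≡ x)

options-length : ∀ S n t → length (options S n t) ≤ length S
options-length []      n t = z≤n
options-length (s ∷ S) n t with (1 ≤ᵇ s) ∧ (s ≤ᵇ n)
... | true  = s≤s (options-length S n t)
... | false = m≤n⇒m≤1+n (options-length S n t)

options-complete : ∀ S n t x → Reaches S n t x → x ∈ options S n t
options-complete (s ∷ S) n t x (.s , here refl , 1≤s , s≤n , refl)
  rewrite legal⇒guard 1≤s s≤n = here refl
options-complete (s ∷ S) n t x (s′ , there s′∈S , reach) with (1 ≤ᵇ s) ∧ (s ≤ᵇ n)
... | true  = there (options-complete S n t x (s′ , s′∈S , reach))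
... | false = options-complete S n t x (s′ , s′∈S , reach)

options-sound : ∀ S n t x → x ∈ options S n t → Reaches S n t x
options-sound (s ∷ S) n t x x∈ with (1 ≤ᵇ s) ∧ (s ≤ᵇ n) in guard
options-sound (s ∷ S) n t x (here refl) | true =
  let (1≤s , s≤n) = guard⇒legal s n guard in s , here refl , 1≤s , s≤n , refl
options-sound (s ∷ S) n t x (there x∈) | true = shift (options-sound S n t x x∈)
  where shift : Reaches S n t x → Reaches (s ∷ S) n t x
        shift (s′ , s′∈S , reach) = s′ , there s′∈S , reach
options-sound (s ∷ S) n t x x∈ | false with (s′ , s′∈S , reach) ← options-sound S n t x x∈ =
  s′ , there s′∈S , reach

table-nth : ∀ S n s → 1 ≤ s → s ≤ n → nth (table S n) (s ∸ 1) ≡ nimValue S (n ∸ s)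
table-nth S (suc n) (suc zero)    _ _           = refl
table-nth S (suc n) (suc (suc s)) _ (s≤s s<n) = table-nth S n (suc s) (s≤s z≤n) s<n

MexRule : List ℕ → (ℕ → ℕ) → ℕ → Set
MexRule S f n =
  (∀ j → j < f n → ∃[ s ] (s ∈ S × 1 ≤ s × s ≤ n × f (n ∸ s) ≡ j))
  × (∀ s → s ∈ S → 1 ≤ s → s ≤ n → f (n ∸ s) ≢ f n)

-- A function obeying the mex recursion everywhere is the nim-value function.
-- (Defs' mex is checked on option lists of length ≤ 3, hence |S| ≤ 3.)
nimValue-unique : ∀ S f → length S ≤ 3 → (∀ n → MexRule S f n) → ∀ n → nimValue S n ≡ f n
nimValue-unique S f |S|≤3 rule = <-rec (λ n → nimValue S n ≡ f n) step
  where
  step : ∀ n → (∀ {m} → m < n → nimValue S m ≡ f m) → nimValue S n ≡ f n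
  step n IH = mex-spec (options S n (table S n)) (f n)
    (≤-trans (options-length S n (table S n)) |S|≤3) reached unreached
    where
    G≡f : ∀ s → 1 ≤ s → s ≤ n → nth (table S n) (s ∸ 1) ≡ f (n ∸ s)
    G≡f s 1≤s s≤n = trans (table-nth S n s 1≤s s≤n) (IH (∸-monoʳ-< 1≤s s≤n))
    reached : ∀ j → j < f n → j ∈ options S n (table S n)
    reached j j<fn with (s , s∈S , 1≤s , s≤n , fj) ← proj₁ (rule n) j j<fn =
      options-complete S n (table S n) j (s , s∈S , 1≤s , s≤n , trans (G≡f s 1≤s s≤n) fj)
    unreached : f n ∉ options S n (table S n)
    unreached fn∈ with (s , s∈S , 1≤s , s≤n , fn) ← options-sound S n (table S n) (f n) fn∈ =
      proj₂ (rule n) s s∈S 1≤s s≤n (trans (sym (G≡f s 1≤s s≤n)) fn)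

odd : ℕ → Bool
odd zero          = false
odd (suc zero)    = true
odd (suc (suc n)) = odd n

odd-suc : ∀ n → odd (suc n) ≡ not (odd n)
odd-suc zero          = refl
odd-suc (suc zero)    = refl
odd-suc (suc (suc n)) = odd-suc n

odd-+ : ∀ m n → odd (m + n) ≡ odd m xor odd n
odd-+ zero          n = refl
odd-+ (suc zero)    n = odd-suc n
odd-+ (suc (suc m)) n = odd-+ m n

odd-∸ : ∀ m n → n ≤ m → odd (m ∸ n) ≡ odd m xor odd n
odd-∸ m n n≤m = begin
  odd (m ∸ n)                         ≡⟨ sym (xor-identityʳ _) ⟩
  odd (m ∸ n) xor false               ≡⟨ cong (odd (m ∸ n) xor_) (sym (xor-same (odd n))) ⟩
  odd (m ∸ n) xor (odd n xor odd n)   ≡⟨ sym (xor-assoc (odd (m ∸ n)) (odd n) (odd n)) ⟩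
  (odd (m ∸ n) xor odd n) xor odd n   ≡⟨ cong (_xor odd n) (sym (odd-+ (m ∸ n) n)) ⟩
  odd (m ∸ n + n) xor odd n           ≡⟨ cong (λ k → odd k xor odd n) (m∸n+n≡m n≤m) ⟩
  odd m xor odd n                     ∎
  where open ≡-Reasoning

odd-+-odd : ∀ m n → odd n ≡ true → odd (m + n) ≡ not (odd m)
odd-+-odd m n odd-n rewrite odd-+ m n | odd-n = xor-comm (odd m) true

odd-+-even : ∀ m n → odd n ≡ false → odd (m + n) ≡ odd m
odd-+-even m n even-n rewrite odd-+ m n | even-n = xor-identityʳ (odd m)

odd-∸-odd : ∀ m n → n ≤ m → odd n ≡ true → odd (m ∸ n) ≡ not (odd m)
odd-∸-odd m n n≤m odd-n rewrite odd-∸ m n n≤m | odd-n = xor-comm (odd m) true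

odd-∸-even : ∀ m n → n ≤ m → odd n ≡ false → odd (m ∸ n) ≡ odd m
odd-∸-even m n n≤m even-n rewrite odd-∸ m n n≤m | even-n = xor-identityʳ (odd m)

odd-double : ∀ i → odd (2 * i) ≡ false
odd-double zero    = refl
odd-double (suc i) rewrite *-suc 2 i = odd-double i

odd-double+1 : ∀ i → odd (2 * i + 1) ≡ true
odd-double+1 i rewrite odd-+ (2 * i) 1 | odd-double i = refl

even⇒double : ∀ n → odd n ≡ false → ∃[ i ] n ≡ 2 * i
odd⇒double+1 : ∀ n → odd n ≡ true → ∃[ i ] n ≡ 2 * i + 1
even⇒double zero _ = 0 , refl
even⇒double (suc n) e with (i , n≡2i+1) ← odd⇒double+1 n (not-injective (trans (sym (odd-suc n)) e)) =
  suc i , (begin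
    suc n          ≡⟨ cong suc n≡2i+1 ⟩
    suc (2 * i + 1) ≡⟨ cong suc (+-comm (2 * i) 1) ⟩
    2 + 2 * i      ≡⟨ sym (*-suc 2 i) ⟩
    2 * suc i      ∎)
  where open ≡-Reasoning
odd⇒double+1 zero ()
odd⇒double+1 (suc n) o with (i , n≡2i) ← even⇒double n (not-injective (trans (sym (odd-suc n)) o)) =
  i , trans (cong suc n≡2i) (+-comm 1 (2 * i))

∸-<-+ : ∀ {m n o} → n ≤ m → m < n + o → m ∸ n < o
∸-<-+ {m} {n} {o} n≤m m<n+o =
  +-cancelˡ-< n (m ∸ n) o (subst (_< n + o) (sym (m+[n∸m]≡n n≤m)) m<n+o)

∸-+-swap : ∀ {n q} → n ≤ q → ∀ c p → n + c ≡ p → q ∸ n + p ≡ c + q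
∸-+-swap {n} {q} n≤q c p n+c≡p = begin
  q ∸ n + p        ≡⟨ cong (q ∸ n +_) (sym n+c≡p) ⟩
  q ∸ n + (n + c)  ≡⟨ sym (+-assoc (q ∸ n) n c) ⟩
  q ∸ n + n + c    ≡⟨ cong (_+ c) (m∸n+n≡m n≤q) ⟩
  q + c            ≡⟨ +-comm q c ⟩
  c + q            ∎
  where open ≡-Reasoning

module _ {p : ℕ} .{{_ : NonZero p}} where

  %-remainder : ∀ k r → r < p → (k * p + r) % p ≡ r
  %-remainder k r r<p = begin
    (k * p + r) % p ≡⟨ %-congˡ (+-comm (k * p) r) ⟩
    (r + k * p) % p ≡⟨ [m+kn]%n≡m%n r k p ⟩
    r % p           ≡⟨ m<n⇒m%n≡m r<p ⟩
    r               ∎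
    where open ≡-Reasoning

  %-wrap : ∀ m → p ≤ m → m < p + p → m % p ≡ m ∸ p
  %-wrap m p≤m m<2p = begin
    m % p       ≡⟨ sym (m≤n⇒[n∸m]%m≡n%m p≤m) ⟩
    (m ∸ p) % p ≡⟨ m<n⇒m%n≡m (∸-<-+ p≤m m<2p) ⟩
    m ∸ p       ∎
    where open ≡-Reasoning

  %-∸ : ∀ n s → s ≤ n % p → (n ∸ s) % p ≡ n % p ∸ s
  %-∸ n s s≤r = begin
    (n ∸ s) % p                    ≡⟨ %-congˡ (cong (_∸ s) (m≡m%n+[m/n]*n n p)) ⟩
    (n % p + n / p * p ∸ s) % p    ≡⟨ %-congˡ (+-∸-comm (n / p * p) s≤r) ⟩
    (n % p ∸ s + n / p * p) % p    ≡⟨ [m+kn]%n≡m%n (n % p ∸ s) (n / p) p ⟩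
    (n % p ∸ s) % p                ≡⟨ m<n⇒m%n≡m (≤-<-trans (m∸n≤m (n % p) s) (m%n<n n p)) ⟩
    n % p ∸ s                      ∎
    where open ≡-Reasoning

  %-+ : ∀ m s → (m % p + s) % p ≡ (m + s) % p
  %-+ m s = begin
    (m % p + s) % p             ≡⟨ %-distribˡ-+ (m % p) s p ⟩
    (m % p % p + s % p) % p     ≡⟨ cong (λ x → (x + s % p) % p) (m%n%n≡m%n m p) ⟩
    (m % p + s % p) % p         ≡⟨ sym (%-distribˡ-+ m s p) ⟩
    (m + s) % p                 ∎
    where open ≡-Reasoning

  star⇒residue : ∀ X → (∀ x → X x → x < p) → ∀ s → StarClosure X p s → X (s % p)
  star⇒residue X X<p s (x , m , Xx , s≡x+mp) =
    subst X (sym (trans (%-congˡ (trans s≡x+mp (+-comm x (m * p)))) (%-remainder m x (X<p x Xx)))) Xx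

  residue⇒star : ∀ X s → X (s % p) → StarClosure X p s
  residue⇒star X s Xr = s % p , s / p , Xr , m≡m%n+[m/n]*n s p

length-rep : ∀ m w → length (rep m w) ≡ m * length w
length-rep zero    w = refl
length-rep (suc m) w = trans (length-++ w) (cong (length w +_) (length-rep m w))

nth-alternating : ∀ m u v z r → r < 2 * m → nth (rep m (u ∷ v ∷ []) ++ z) r ≡ (if odd r then v else u)
nth-alternating (suc m) u v z zero          _ = refl
nth-alternating (suc m) u v z (suc zero)    _ = refl
nth-alternating (suc m) u v z (suc (suc r)) r+2<2m+2 =
  nth-alternating m u v z r (+-cancelˡ-< 2 r (2 * m) (subst (2 + r <_) (*-suc 2 m) r+2<2m+2))

nth-after-alternating : ∀ m u v z r → nth (rep m (u ∷ v ∷ []) ++ z) (2 * m + r) ≡ nth z r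
nth-after-alternating zero    u v z r = refl
nth-after-alternating (suc m) u v z r =
  trans (cong (λ i → nth (rep (suc m) (u ∷ v ∷ []) ++ z) (i + r)) (*-suc 2 m)) (nth-after-alternating m u v z r)

-- The four nim-values: the first flag chooses the low pair {0,1} or the high
-- pair {2,3}, the parity flag the member of the pair.
value : Bool → Bool → ℕ
value true  false = 0
value true  true  = 1
value false false = 2
value false true  = 3

value-odd : ∀ c d → odd (value c d) ≡ d
value-odd true  false = refl
value-odd true  true  = refl
value-odd false false = refl
value-odd false true  = refl

value-low : ∀ c d → (value c d <ᵇ 2) ≡ c
value-low true  false = refl
value-low true  true  = refl
value-low false false = refl
value-low false true  = refl

by-parity : ∀ c d → (if d then value c true else value c false) ≡ value c d
by-parity c true  = refl
by-parity c false = refl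

below-low : ∀ d j → j < value true d → d ≡ true × j ≡ 0
below-low true zero    _             = refl , refl
below-low true (suc j) (s≤s ())

below-high : ∀ d j → j < value false d →
  (j ≡ value true d ⊎ j ≡ value true (not d)) ⊎ (d ≡ true × j ≡ 2)
below-high false zero       _ = inj₁ (inj₁ refl)
below-high false (suc zero) _ = inj₁ (inj₂ refl)
below-high true  zero       _ = inj₁ (inj₂ refl)
below-high true  (suc zero) _ = inj₁ (inj₁ refl)
below-high true  (suc (suc zero)) _ = inj₂ (refl , refl)
below-high false (suc (suc _)) (s≤s (s≤s ()))
below-high true  (suc (suc (suc _))) (s≤s (s≤s (s≤s ())))

odd-halves : ∀ a → a % 2 ≡ 1 → a ≡ 2 * ((a ∸ 1) / 2) + 1
odd-halves a a%2≡1 = begin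
  a                      ≡⟨ trans (m≡m%n+[m/n]*n a 2) (cong (_+ a / 2 * 2) a%2≡1) ⟩
  1 + a / 2 * 2          ≡⟨ cong (1 +_) (*-comm (a / 2) 2) ⟩
  1 + 2 * (a / 2)        ≡⟨ cong (λ i → 1 + 2 * i) (sym half-pred) ⟩
  1 + 2 * ((a ∸ 1) / 2)  ≡⟨ +-comm 1 _ ⟩
  2 * ((a ∸ 1) / 2) + 1  ∎
  where
  open ≡-Reasoning
  half-pred : (a ∸ 1) / 2 ≡ a / 2
  half-pred = trans (/-congˡ (cong (_∸ 1) (trans (m≡m%n+[m/n]*n a 2) (cong (_+ a / 2 * 2) a%2≡1))))
                    (m*n/n≡m (a / 2) 2)

even-halves : ∀ b → b % 2 ≡ 0 → b ≡ 2 * (b / 2)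
even-halves b b%2≡0 = trans (trans (m≡m%n+[m/n]*n b 2) (cong (_+ b / 2 * 2) b%2≡0)) (*-comm (b / 2) 2)

module SubtractionGame (a b h k : ℕ) (a≡2h+1 : a ≡ 2 * h + 1) (b≡2k : b ≡ 2 * k) (a<b : a < b) where

  S : List ℕ
  S = 1 ∷ a ∷ b ∷ []

  G : ℕ → ℕ
  G = nimValue S

  p : ℕ
  p = a + b

  a-odd : odd a ≡ true
  a-odd = subst (λ x → odd x ≡ true) (sym a≡2h+1) (odd-double+1 h)

  b-even : odd b ≡ false
  b-even = subst (λ x → odd x ≡ false) (sym b≡2k) (odd-double k)

  p-odd : odd p ≡ true
  p-odd rewrite odd-+ a b | a-odd | b-even = refl

  1≤a : 1 ≤ a
  1≤a = subst (1 ≤_) (trans (+-comm 1 (2 * h)) (sym a≡2h+1)) (s≤s z≤n)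

  1≤b : 1 ≤ b
  1≤b = ≤-trans 1≤a (<⇒≤ a<b)

  b<p : b < p
  b<p = subst (b <_) (+-comm b a) (m<m+n b 1≤a)

  instance
    p-nonZero : NonZero p
    p-nonZero = >-nonZero (≤-<-trans z≤n b<p)

  -- The claimed nim-value at residue r < p: the word (01)^k (23)^h 2 read at r.
  isLow : ℕ → Bool
  isLow r = r <ᵇ b

  g : ℕ → ℕ
  g r = value (isLow r) (odd r)

  isLow-true : ∀ {r} → r < b → isLow r ≡ true
  isLow-true r<b = Equivalence.to T-≡ (<⇒<ᵇ r<b)

  isLow-false : ∀ {r} → b ≤ r → isLow r ≡ false
  isLow-false {r} b≤r with isLow r in low
  ... | true  = ⊥-elim (≤⇒≯ b≤r (<ᵇ⇒< r b (Equivalence.from T-≡ low)))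
  ... | false = refl

  g-parity : ∀ {x y} → odd x ≡ not (odd y) → g x ≢ g y
  g-parity {x} {y} flipped gx≡gy = not-¬ refl (begin
    odd y                     ≡⟨ sym (value-odd (isLow y) (odd y)) ⟩
    odd (g y)                 ≡⟨ cong odd (sym gx≡gy) ⟩
    odd (g x)                 ≡⟨ value-odd (isLow x) (odd x) ⟩
    odd x                     ≡⟨ flipped ⟩
    not (odd y)               ∎)
    where open ≡-Reasoning

  g-level : ∀ {x y} → x < b → b ≤ y → g x ≢ g y
  g-level {x} {y} x<b b≤y gx≡gy = true≢false (begin
    true                      ≡⟨ sym (isLow-true x<b) ⟩
    isLow x                   ≡⟨ sym (value-low (isLow x) (odd x)) ⟩
    (g x <ᵇ 2)                ≡⟨ cong (_<ᵇ 2) gx≡gy ⟩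
    (g y <ᵇ 2)                ≡⟨ value-low (isLow y) (odd y) ⟩
    isLow y                   ≡⟨ isLow-false b≤y ⟩
    false                     ∎)
    where open ≡-Reasoning
          true≢false : true ≢ false
          true≢false ()

  g-zero : ∀ {x} → x < b → odd x ≡ false → g x ≡ 0
  g-zero {x} x<b even rewrite isLow-true x<b | even = refl

  -- From an odd residue, removing 1 stays inside the block (b is even).
  step-1 : ∀ r → odd r ≡ true → 1 ≤ r × g (r ∸ 1) ≡ value (isLow r) false
  step-1 zero    ()
  step-1 (suc r) odd-r = s≤s z≤n , cong₂ value same-block even-r
    where
    even-r : odd r ≡ false
    even-r = not-injective (trans (sym (odd-suc r)) odd-r)
    same-block : isLow r ≡ isLow (suc r)
    same-block with suc r <? b
    ... | yes r+1<b = trans (isLow-true (<-trans (n<1+n r) r+1<b)) (sym (isLow-true r+1<b))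
    ... | no  r+1≮b = trans (isLow-false b≤r) (sym (isLow-false (≤-trans b≤r (n≤1+n r))))
      where
      b≢r+1 : b ≢ suc r
      b≢r+1 b≡r+1 = case-parity (trans (sym b-even) (trans (cong odd b≡r+1) odd-r))
        where case-parity : false ≢ true
              case-parity ()
      b≤r : b ≤ r
      b≤r = ≤-pred (≤∧≢⇒< (≮⇒≥ r+1≮b) b≢r+1)

  step-a : ∀ r → b ≤ r → r < p → a ≤ r × g (r ∸ a) ≡ value true (not (odd r))
  step-a r b≤r r<p = a≤r , cong₂ value (isLow-true (∸-<-+ a≤r r<p)) (odd-∸-odd r a a≤r a-odd)
    where a≤r : a ≤ r
          a≤r = ≤-trans (<⇒≤ a<b) b≤r

  step-b : ∀ r → b ≤ r → r < p → g (r ∸ b) ≡ value true (odd r)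
  step-b r b≤r r<p =
    cong₂ value (isLow-true (<-trans (∸-<-+ b≤r (subst (r <_) (+-comm a b) r<p)) a<b))
                (odd-∸-even r b b≤r b-even)

  Hit : ℕ → ℕ → Set
  Hit r j = ∃[ s ] (s ∈ S × 1 ≤ s × s ≤ r × g (r ∸ s) ≡ j)

  hits : ∀ r → r < p → ∀ j → j < g r → Hit r j
  hits r r<p j j<gr with r <? b
  ... | yes r<b with below-low (odd r) j (subst (j <_) (cong (λ c → value c (odd r)) (isLow-true r<b)) j<gr)
  ...   | odd-r , refl with (1≤r , g[r-1]) ← step-1 r odd-r =
    1 , here refl , s≤s z≤n , 1≤r , trans g[r-1] (cong (λ c → value c false) (isLow-true r<b))
  hits r r<p j j<gr | no r≮b
    with below-high (odd r) j (subst (j <_) (cong (λ c → value c (odd r)) (isLow-false (≮⇒≥ r≮b))) j<gr)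
  ... | inj₁ (inj₁ refl) = b , there (there (here refl)) , 1≤b , ≮⇒≥ r≮b , step-b r (≮⇒≥ r≮b) r<p
  ... | inj₁ (inj₂ refl) with (a≤r , g[r-a]) ← step-a r (≮⇒≥ r≮b) r<p =
    a , there (here refl) , 1≤a , a≤r , g[r-a]
  ... | inj₂ (odd-r , refl) with (1≤r , g[r-1]) ← step-1 r odd-r =
    1 , here refl , s≤s z≤n , 1≤r , trans g[r-1] (cong (λ c → value c false) (isLow-false (≮⇒≥ r≮b)))

  Separates : ℕ → Set
  Separates t = ∀ r → r < p → g ((r + t) % p) ≢ g r

  Expanding : ℕ → Set
  Expanding t = (odd t ≡ true × t ≤ a) ⊎ (odd t ≡ false × b ≤ t × t < p)

  -- An odd shift t ≤ a flips the parity, unless it wraps around; then it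
  -- moves from the high block into the low one.
  odd-separates : ∀ t → odd t ≡ true → t ≤ a → Separates t
  odd-separates t odd-t t≤a r r<p with r + t <? p
  ... | yes r+t<p rewrite m<n⇒m%n≡m r+t<p = g-parity (odd-+-odd r t odd-t)
  ... | no  r+t≮p rewrite %-wrap (r + t) (≮⇒≥ r+t≮p) (+-mono-< r<p (≤-<-trans t≤a (m<m+n a 1≤b))) =
    g-level low high
    where
    p≤r+t : p ≤ r + t
    p≤r+t = ≮⇒≥ r+t≮p
    low : r + t ∸ p < b
    low = <-≤-trans (∸-<-+ p≤r+t (+-monoˡ-< t r<p)) (≤-trans t≤a (<⇒≤ a<b))
    high : b ≤ r
    high = +-cancelʳ-≤ a b r (subst (_≤ r + a) (+-comm a b) (≤-trans p≤r+t (+-monoʳ-≤ r t≤a)))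

  -- An even shift b ≤ t < p moves the low block into the high one, unless it
  -- wraps around; then (p being odd) it flips the parity.
  even-separates : ∀ t → odd t ≡ false → b ≤ t → t < p → Separates t
  even-separates t even-t b≤t t<p r r<p with r + t <? p
  ... | yes r+t<p rewrite m<n⇒m%n≡m r+t<p = ≢-sym (g-level low (≤-trans b≤t (m≤n+m t r)))
    where
    low : r < b
    low = <-trans (+-cancelʳ-< b r a (≤-<-trans (+-monoʳ-≤ r b≤t) r+t<p)) a<b
  ... | no  r+t≮p rewrite %-wrap (r + t) (≮⇒≥ r+t≮p) (+-mono-< r<p t<p) =
    g-parity (trans (odd-∸-odd (r + t) p (≮⇒≥ r+t≮p) p-odd) (cong not (odd-+-even r t even-t)))

  expanding⇒separates : ∀ t → Expanding t → Separates t
  expanding⇒separates t (inj₁ (odd-t , t≤a))          = odd-separates t odd-t t≤a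
  expanding⇒separates t (inj₂ (even-t , b≤t , t<p)) = even-separates t even-t b≤t t<p

  -- Conversely an odd t > a fails at r = p - t, and an even t < b fails at r = 0:
  -- both places carry the value 0, as does the residue 0 they map to.
  separates⇒expanding : ∀ t → t < p → Separates t → Expanding t
  separates⇒expanding t t<p separates with odd t in parity-t
  ... | true with t ≤? a
  ...   | yes t≤a = inj₁ (refl , t≤a)
  ...   | no  t≰a = ⊥-elim (separates (p ∸ t) (∸-monoʳ-< 0<t t≤p) (begin
    g ((p ∸ t + t) % p)  ≡⟨ cong (λ m → g (m % p)) (m∸n+n≡m t≤p) ⟩
    g (p % p)            ≡⟨ cong g (n%n≡0 p) ⟩
    g 0                  ≡⟨ g-zero 1≤b refl ⟩
    0                    ≡⟨ sym (g-zero low (trans (odd-∸-odd p t t≤p parity-t) (cong not p-odd))) ⟩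
    g (p ∸ t)            ∎))
    where
    open ≡-Reasoning
    t≤p : t ≤ p
    t≤p = <⇒≤ t<p
    0<t : 0 < t
    0<t = ≤-<-trans z≤n (≰⇒> t≰a)
    low : p ∸ t < b
    low = subst (p ∸ t <_) (m+n∸m≡n a b) (∸-monoʳ-< (≰⇒> t≰a) t≤p)
  separates⇒expanding t t<p separates | false with b ≤? t
  ...   | yes b≤t = inj₂ (refl , b≤t , t<p)
  ...   | no  b≰t = ⊥-elim (separates 0 (≤-<-trans z≤n b<p) (begin
    g (t % p)  ≡⟨ cong g (m<n⇒m%n≡m t<p) ⟩
    g t        ≡⟨ g-zero (≰⇒> b≰t) parity-t ⟩
    0          ≡⟨ sym (g-zero 1≤b refl) ⟩
    g 0        ∎))
    where open ≡-Reasoning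

  moves-separate : ∀ s → s ∈ S → Separates s
  moves-separate .1 (here refl)                 = odd-separates 1 refl 1≤a
  moves-separate .a (there (here refl))         = odd-separates a a-odd ≤-refl
  moves-separate .b (there (there (here refl))) = even-separates b b-even ≤-refl b<p

  -- Reading g cyclically obeys the mex recursion: smaller values are hit by
  -- non-wrapping moves, and no move keeps the value since every move separates.
  cyclic-rule : ∀ n → MexRule S (λ m → g (m % p)) n
  cyclic-rule n = reach , avoid
    where
    reach : ∀ j → j < g (n % p) → ∃[ s ] (s ∈ S × 1 ≤ s × s ≤ n × g ((n ∸ s) % p) ≡ j)
    reach j j<g with (s , s∈S , 1≤s , s≤r , g≡j) ← hits (n % p) (m%n<n n p) j j<g =
      s , s∈S , 1≤s , ≤-trans s≤r (m%n≤m n p) , trans (cong g (%-∸ n s s≤r)) g≡j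
    avoid : ∀ s → s ∈ S → 1 ≤ s → s ≤ n → g ((n ∸ s) % p) ≢ g (n % p)
    avoid s s∈S _ s≤n same = moves-separate s s∈S ((n ∸ s) % p) (m%n<n (n ∸ s) p) (begin
      g (((n ∸ s) % p + s) % p)  ≡⟨ cong g (%-+ (n ∸ s) s) ⟩
      g ((n ∸ s + s) % p)        ≡⟨ cong (λ m → g (m % p)) (m∸n+n≡m s≤n) ⟩
      g (n % p)                  ≡⟨ sym same ⟩
      g ((n ∸ s) % p)            ∎)
      where open ≡-Reasoning

  G≡g : ∀ n → G n ≡ g (n % p)
  G≡g = nimValue-unique S (λ m → g (m % p)) (s≤s (s≤s (s≤s z≤n))) cyclic-rule

  G-residue : ∀ r → r < p → G r ≡ g r
  G-residue r r<p = trans (G≡g r) (cong g (m<n⇒m%n≡m r<p))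

  periodic : ∀ n → G (n + p) ≡ G n
  periodic n = trans (G≡g (n + p)) (trans (cong g ([m+n]%n≡m%n n p)) (sym (G≡g n)))

  -- No 0 < q < p is a period: for q < b the shift carries p-1 (high) to q-1
  -- (low), for q ≥ b it carries b (high) to q-a (low).
  no-smaller-period : ∀ q → 1 ≤ q → q < p → ¬ (∀ n → G (n + q) ≡ G n)
  no-smaller-period q 1≤q q<p period with q <? b
  ... | yes q<b = g-level (≤-<-trans (m∸n≤m q 1) q<b) b≤p-1 (begin
    g (q ∸ 1)       ≡⟨ sym (G-residue (q ∸ 1) (≤-<-trans (m∸n≤m q 1) q<p)) ⟩
    G (q ∸ 1)       ≡⟨ sym (periodic (q ∸ 1)) ⟩
    G (q ∸ 1 + p)   ≡⟨ cong G (∸-+-swap 1≤q (p ∸ 1) p (m+[n∸m]≡n 1≤p)) ⟩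
    G (p ∸ 1 + q)   ≡⟨ period (p ∸ 1) ⟩
    G (p ∸ 1)       ≡⟨ G-residue (p ∸ 1) (∸-monoʳ-< (s≤s z≤n) 1≤p) ⟩
    g (p ∸ 1)       ∎)
    where
    open ≡-Reasoning
    1≤p : 1 ≤ p
    1≤p = ≤-trans 1≤b (<⇒≤ b<p)
    b≤p-1 : b ≤ p ∸ 1
    b≤p-1 = ≤-pred (subst (b <_) (sym (m+[n∸m]≡n 1≤p)) b<p)
  ... | no  q≮b = g-level q-a<b ≤-refl (begin
    g (q ∸ a)       ≡⟨ sym (G-residue (q ∸ a) (<-trans q-a<b b<p)) ⟩
    G (q ∸ a)       ≡⟨ sym (periodic (q ∸ a)) ⟩
    G (q ∸ a + p)   ≡⟨ cong G (∸-+-swap a≤q b p refl) ⟩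
    G (b + q)       ≡⟨ period b ⟩
    G b             ≡⟨ G-residue b b<p ⟩
    g b             ∎)
    where
    open ≡-Reasoning
    a≤q : a ≤ q
    a≤q = ≤-trans (<⇒≤ a<b) (≮⇒≥ q≮b)
    q-a<b : q ∸ a < b
    q-a<b = ∸-<-+ a≤q q<p

  G-shift : ∀ n s → G (n + s) ≡ g ((n % p + s % p) % p)
  G-shift n s = trans (G≡g (n + s)) (cong g (%-distribˡ-+ n s p))

  separating⇒separates : ∀ s → (∀ n → G (n + s) ≢ G n) → Separates (s % p)
  separating⇒separates s separating r r<p same = separating r (begin
    G (r + s)                  ≡⟨ G-shift r s ⟩
    g ((r % p + s % p) % p)    ≡⟨ cong (λ x → g ((x + s % p) % p)) (m<n⇒m%n≡m r<p) ⟩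
    g ((r + s % p) % p)        ≡⟨ same ⟩
    g r                        ≡⟨ sym (G-residue r r<p) ⟩
    G r                        ∎)
    where open ≡-Reasoning

  separates⇒separating : ∀ s → Separates (s % p) → ∀ n → G (n + s) ≢ G n
  separates⇒separating s separates n same =
    separates (n % p) (m%n<n n p) (trans (sym (G-shift n s)) (trans same (G≡g n)))

  W : List ℕ
  W = rep k (0 ∷ 1 ∷ []) ++ rep h (2 ∷ 3 ∷ []) ++ (2 ∷ [])

  length-W : length W ≡ p
  length-W = begin
    length W                                   ≡⟨ length-++ (rep k (0 ∷ 1 ∷ [])) ⟩
    length (rep k (0 ∷ 1 ∷ [])) + length (rep h (2 ∷ 3 ∷ []) ++ (2 ∷ []))
                                               ≡⟨ cong₂ _+_ (length-rep k (0 ∷ 1 ∷ [])) (length-++ (rep h (2 ∷ 3 ∷ []))) ⟩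
    k * 2 + (length (rep h (2 ∷ 3 ∷ [])) + 1)  ≡⟨ cong (λ x → k * 2 + (x + 1)) (length-rep h (2 ∷ 3 ∷ [])) ⟩
    k * 2 + (h * 2 + 1)                        ≡⟨ cong₂ (λ x y → x + (y + 1)) (*-comm k 2) (*-comm h 2) ⟩
    2 * k + (2 * h + 1)                        ≡⟨ cong₂ _+_ (sym b≡2k) (sym a≡2h+1) ⟩
    b + a                                      ≡⟨ +-comm b a ⟩
    p                                          ∎
    where open ≡-Reasoning

  nth-high-block : ∀ r → r < a → nth (rep h (2 ∷ 3 ∷ []) ++ (2 ∷ [])) r ≡ value false (odd r)
  nth-high-block r r<a with r <? 2 * h
  ... | yes r<2h = trans (nth-alternating h 2 3 (2 ∷ []) r r<2h) (by-parity false (odd r))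
  ... | no  r≮2h = begin
    nth (rep h (2 ∷ 3 ∷ []) ++ (2 ∷ [])) r           ≡⟨ cong (nth (rep h (2 ∷ 3 ∷ []) ++ (2 ∷ []))) r≡2h+0 ⟩
    nth (rep h (2 ∷ 3 ∷ []) ++ (2 ∷ [])) (2 * h + 0) ≡⟨ nth-after-alternating h 2 3 (2 ∷ []) 0 ⟩
    value false false                                ≡⟨ cong (value false) (sym (odd-double h)) ⟩
    value false (odd (2 * h))                        ≡⟨ cong (λ x → value false (odd x)) (sym r≡2h) ⟩
    value false (odd r)                              ∎
    where
    open ≡-Reasoning
    r≡2h : r ≡ 2 * h
    r≡2h = ≤-antisym (≤-pred (subst (r <_) (trans a≡2h+1 (+-comm (2 * h) 1)) r<a)) (≮⇒≥ r≮2h)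
    r≡2h+0 : r ≡ 2 * h + 0
    r≡2h+0 = trans r≡2h (sym (+-identityʳ (2 * h)))

  nth-W : ∀ r → r < p → nth W r ≡ g r
  nth-W r r<p with r <? b
  ... | yes r<b = begin
    nth W r                   ≡⟨ nth-alternating k 0 1 _ r (subst (r <_) b≡2k r<b) ⟩
    (if odd r then 1 else 0)  ≡⟨ by-parity true (odd r) ⟩
    value true (odd r)        ≡⟨ cong (λ c → value c (odd r)) (sym (isLow-true r<b)) ⟩
    g r                       ∎
    where open ≡-Reasoning
  ... | no  r≮b = begin
    nth W r                   ≡⟨ cong (nth W) (trans (sym (m+[n∸m]≡n b≤r)) (cong (_+ (r ∸ b)) b≡2k)) ⟩
    nth W (2 * k + (r ∸ b))   ≡⟨ nth-after-alternating k 0 1 _ (r ∸ b) ⟩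
    nth (rep h (2 ∷ 3 ∷ []) ++ (2 ∷ [])) (r ∸ b)
                              ≡⟨ nth-high-block (r ∸ b) (∸-<-+ b≤r (subst (r <_) (+-comm a b) r<p)) ⟩
    value false (odd (r ∸ b)) ≡⟨ cong₂ value (sym (isLow-false b≤r)) (odd-∸-even r b b≤r b-even) ⟩
    g r                       ∎
    where
    open ≡-Reasoning
    b≤r : b ≤ r
    b≤r = ≮⇒≥ r≮b

  G-sequence : ∀ c r → r < p → G (c * p + r) ≡ nth W r
  G-sequence c r r<p = trans (G≡g (c * p + r)) (trans (cong g (%-remainder c r r<p)) (sym (nth-W r r<p)))

  periodicity : PeriodicWith S p W
  periodicity = ≤-trans 1≤b (<⇒≤ b<p) , periodic , no-smaller-period , length-W , G-sequence

  X : ℕ → Set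
  X x = (∃[ i ] (i ≤ h × x ≡ 2 * i + 1)) ⊎ (∃[ i ] (i ≤ h × x ≡ b + 2 * i))

  double<a : ∀ {i} → i ≤ h → 2 * i < a
  double<a {i} i≤h = subst (2 * i <_) (trans (+-comm 1 (2 * h)) (sym a≡2h+1)) (s≤s (*-monoʳ-≤ 2 i≤h))

  half≤h : ∀ {i} → 2 * i < a → i ≤ h
  half≤h {i} 2i<a = *-cancelˡ-≤ 2 (≤-pred (subst (2 * i <_) (trans a≡2h+1 (+-comm (2 * h) 1)) 2i<a))

  X⇒expanding : ∀ x → X x → Expanding x
  X⇒expanding x (inj₁ (i , i≤h , refl)) =
    inj₁ (odd-double+1 i , subst (_≤ a) (+-comm 1 (2 * i)) (double<a i≤h))
  X⇒expanding x (inj₂ (i , i≤h , refl)) =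
    inj₂ (trans (odd-+-even b (2 * i) (odd-double i)) b-even , m≤m+n b (2 * i) ,
          subst (b + 2 * i <_) (+-comm b a) (+-monoʳ-< b (double<a i≤h)))

  expanding⇒X : ∀ x → Expanding x → X x
  expanding⇒X x (inj₁ (odd-x , x≤a)) with (i , x≡2i+1) ← odd⇒double+1 x odd-x =
    inj₁ (i , half≤h (<-≤-trans (subst (2 * i <_) (trans (+-comm 1 (2 * i)) (sym x≡2i+1)) ≤-refl) x≤a) , x≡2i+1)
  expanding⇒X x (inj₂ (even-x , b≤x , x<p))
    with (i , x-b≡2i) ← even⇒double (x ∸ b) (trans (odd-∸-even x b b≤x b-even) even-x) =
    inj₂ (i , half≤h (subst (_< a) x-b≡2i (∸-<-+ b≤x (subst (x <_) (+-comm a b) x<p))) ,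
          trans (sym (m+[n∸m]≡n b≤x)) (cong (b +_) x-b≡2i))

  expanding-bounds : ∀ t → Expanding t → 1 ≤ t × t < p
  expanding-bounds zero    (inj₁ (() , _))
  expanding-bounds (suc t) (inj₁ (_ , t≤a))         = s≤s z≤n , ≤-<-trans t≤a (m<m+n a 1≤b)
  expanding-bounds t       (inj₂ (_ , b≤t , t<p)) = ≤-trans 1≤b b≤t , t<p

  expansion : HasExpansion S (StarClosure X p)
  expansion s = forward , backward
    where
    forward : InExpansion S s → StarClosure X p s
    forward (_ , separating) = residue⇒star X s
      (expanding⇒X (s % p) (separates⇒expanding (s % p) (m%n<n s p) (separating⇒separates s separating)))
    backward : StarClosure X p s → InExpansion S s
    backward star = ≤-trans (proj₁ (expanding-bounds (s % p) expanding)) (m%n≤m s p) ,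
                    separates⇒separating s (expanding⇒separates (s % p) expanding)
      where
      X<p : ∀ x → X x → x < p
      X<p x Xx = proj₂ (expanding-bounds x (X⇒expanding x Xx))
      expanding : Expanding (s % p)
      expanding = X⇒expanding (s % p) (star⇒residue X X<p s star)

theorem3p1 : (a b : ℕ) → 1 ≤ a → a % 2 ≡ 1 → 1 ≤ b → b % 2 ≡ 0 → a < b →
    PeriodicWith (1 ∷ a ∷ b ∷ []) (a + b)
      (rep (b / 2) (0 ∷ 1 ∷ []) ++ rep ((a ∸ 1) / 2) (2 ∷ 3 ∷ []) ++ (2 ∷ []))
    × HasExpansion (1 ∷ a ∷ b ∷ [])
        (StarClosure
          (λ x → (∃[ i ] (i ≤ (a ∸ 1) / 2 × x ≡ 2 * i + 1))
               ⊎ (∃[ i ] (i ≤ (a ∸ 1) / 2 × x ≡ b + 2 * i)))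
          (a + b))
theorem3p1 a b _ a%2≡1 _ b%2≡0 a<b = periodicity , expansion
  where open SubtractionGame a b ((a ∸ 1) / 2) (b / 2) (odd-halves a a%2≡1) (even-halves b b%2≡0) a<b
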